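{- Let $\mathcal C=(V,\mathcal I,\mathcal D)$ be a configuration such that for all $x,y\in\mathcal I$ with $|x|=|y|$, the relative configurations $\mathcal C^{\parallel x}$ and $\mathcal C^{\parallel y}$ are isomorphic. For $j\geq 0$, let $\eta_j=\#V^{\parallel x}$ for any $x\in\mathcal I$ with $|x|=j$ (with $\eta_j=0$ if there is no independence set of size $j$), and let $N_j=\#\{x\in\mathcal I : |x|=j\}$. Then for every $k\geq 0$, $$N_k=\frac{1}{k!}\,\eta_0\eta_1\cdots\eta_{k-1}.$$
   Context: A configuration is a triple $(V,\mathcal I,\mathcal D)$ where $V$ is a finite set, $\mathcal I\subseteq\mathcal P(V)$ is non empty, downward closed under inclusion and contains every singleton, and $\mathcal D=\mathcal P(V)\setminus\mathcal I$. For $x,y\in\mathcal I$, $x\parallel y$ means $x\cap y=\emptyset$ and $x\cup y\in\mathcal I$. For $x\in\mathcal I$, the relative configuration $\mathcal C^{\parallel x}=(V^{\parallel x},\mathcal I^{\parallel x},\mathcal P(V^{\parallel x})\setminus\mathcal I^{\parallel x})$ has $V^{\parallel x}=\{a\in V: x\parallel\{a\}\}$ and $\mathcal I^{\parallel x}=\{y\in\mathcal I\cap\mathcal P(V^{\parallel x}): x\parallel y\}$. Two configurations $(V,\mathcal I,\mathcal D)$, $(V',\mathcal I',\mathcal D')$ are isomorphic if there is a bijection $V\to V'$ mapping $\mathcal I$ onto $\mathcal I'$. For $k=0$ the empty product equals $1$. -}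

module Defs where

open import Data.Nat using (ℕ; zero; suc; _*_; _≡ᵇ_)
open import Data.Bool using (Bool; true; false; _∧_; not; if_then_else_)
open import Data.Fin using (Fin)
open import Data.Fin.Subset using (Subset; ⁅_⁆; _⊆_; _∪_; ∣_∣)
open import Data.Vec using (Vec; []; _∷_; tabulate)
open import Data.List using (List; []; _∷_; _++_; map; filter; length)
open import Data.Product using (Σ; _×_; _,_)
open import Relation.Binary.PropositionalEquality using (_≡_; refl)
open import Relation.Nullary using (¬_)
open import Data.Bool using (T)
open import Relation.Nullary.Decidable using (yes; no)
open import Data.Bool.Properties using (T?)
open import Function.Bundles using (_↔_; Inverse)

-- The family 𝓘 is given as a Bool-valued (hence decidable) predicate;
-- 𝓓 = P(V) ∖ 𝓘 is its complement and needs no separate data.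
record Configuration (n : ℕ) : Set where
  field
    I          : Subset n → Bool
    nonempty   : Σ (Subset n) (λ x → I x ≡ true)
    downClosed : ∀ {x y : Subset n} → y ⊆ x → I x ≡ true → I y ≡ true
    singletons : ∀ (a : Fin n) → I ⁅ a ⁆ ≡ true

disjointᵇ : ∀ {n} → Subset n → Subset n → Bool
disjointᵇ [] [] = true
disjointᵇ (a ∷ x) (b ∷ y) = not (a ∧ b) ∧ disjointᵇ x y

module _ {n : ℕ} (C : Configuration n) where
  open Configuration C

  _∥_ : Subset n → Subset n → Bool
  x ∥ y = disjointᵇ x y ∧ I (x ∪ y)

  Vpar : Subset n → Set
  Vpar x = Σ (Fin n) (λ a → T (x ∥ ⁅ a ⁆))

  VparSet : Subset n → Subset n
  VparSet x = tabulate (λ a → x ∥ ⁅ a ⁆)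

  #Vpar : Subset n → ℕ
  #Vpar x = ∣ VparSet x ∣

  embed : (x : Subset n) → (Vpar x → Bool) → Subset n
  embed x S = tabulate (λ a → go a (T? (x ∥ ⁅ a ⁆)))
    where
    go : (a : Fin n) → _ → Bool
    go a (yes p) = S (a , p)
    go a (no _)  = false

  Ipar : (x : Subset n) → (Vpar x → Bool) → Bool
  Ipar x S = I (embed x S) ∧ (x ∥ embed x S)

  -- C^{∥x} ≅ C^{∥y}: a bijection f : V^{∥x} → V^{∥y} mapping 𝓘^{∥x} onto 𝓘^{∥y}
  -- (the image of S under f has characteristic function S ∘ f⁻¹).
  RelIso : Subset n → Subset n → Set
  RelIso x y = Σ (Vpar x ↔ Vpar y) (λ f →
    ∀ (S : Vpar x → Bool) → Ipar x S ≡ Ipar y (λ b → S (Inverse.from f b)))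

allSubsets : (n : ℕ) → List (Subset n)
allSubsets zero = [] ∷ []
allSubsets (suc n) = map (true ∷_) (allSubsets n) ++ map (false ∷_) (allSubsets n)

N : ∀ {n} → Configuration n → ℕ → ℕ
N {n} C k = length (filter (λ x → T? (Configuration.I C x ∧ (∣ x ∣ ≡ᵇ k))) (allSubsets n))

prodBelow : (ℕ → ℕ) → ℕ → ℕ
prodBelow η zero = 1
prodBelow η (suc k) = prodBelow η k * η k

-- Double counting: (x, a) ↦ (x ∪ {a}, a) is a bijection from the pairs with x ∈ 𝓘, |x| = k,
-- a ∈ V^{∥x} onto the pairs with y ∈ 𝓘, |y| = k + 1, a ∈ y; its inverse removes a and stays in
-- 𝓘 by downward closure. Hence η_k N_k = (k + 1) N_{k+1}, and since ∅ ∈ 𝓘 gives N_0 = 1,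
-- induction on k yields the formula.
-- The isomorphism hypothesis only makes η well defined.
module Submission where

open import Defs
open import Data.Bool using (Bool; true; false; T; not; _∧_)
open import Data.Bool.Properties using (T-≡; T-∧; ∧-identityʳ; ∧-zeroʳ)
open import Data.Fin using (Fin; zero; suc)
open import Data.Fin.Subset using (Subset; inside; outside; ⊥; ⁅_⁆; _∪_; _⊆_; ∣_∣)
open import Data.Fin.Subset.Properties using (⊆-min; ∪-identityʳ)
open import Data.List using (List; []; _∷_; _++_; map; filter; length)
open import Data.List.Properties using (map-++; map-∘)
open import Data.Nat using (ℕ; zero; suc; _+_; _*_; _!; _≡ᵇ_)
open import Data.Nat.ListAction using (sum)
open import Data.Nat.ListAction.Properties using (sum-++)
open import Data.Nat.Properties using (+-comm; *-comm; *-distribˡ-+; *-assoc; *-zeroʳ; ≡ᵇ⇒≡; +-*-semiring)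
open import Data.Product using (Σ; _×_; _,_; proj₁; proj₂)
open import Data.Vec using ([]; _∷_; here; there; lookup; _[_]≔_)
open import Data.Vec.Properties using (lookup∘tabulate)
open import Function using (_∘_; Equivalence)
open import Relation.Binary.PropositionalEquality
  using (_≡_; refl; sym; trans; cong; cong₂; module ≡-Reasoning)
open import Relation.Nullary using (¬_)
open import Relation.Nullary.Decidable using (T?)

open import Algebra.Properties.Semiring.Sum +-*-semiring
  using (sum-syntax; sum-cong-≗; ∑-distrib-+; *-distribʳ-sum)

open ≡-Reasoning

χ : Bool → ℕ
χ true  = 1
χ false = 0

χ-∧ : ∀ b c → χ (b ∧ c) ≡ χ b * χ c
χ-∧ true  c = sym (+-comm (χ c) 0)
χ-∧ false c = refl

*-χ-cong : ∀ b {m n} → (T b → m ≡ n) → m * χ b ≡ n * χ b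
*-χ-cong true  m≡n = cong (_* 1) (m≡n _)
*-χ-cong false {m} {n} _ = trans (*-zeroʳ m) (sym (*-zeroʳ n))

∧-drop-implied : ∀ {b} c d → (c ≡ true → b ≡ true) → c ∧ (b ∧ d) ≡ c ∧ d
∧-drop-implied false d _ = refl
∧-drop-implied true  d c⇒b rewrite c⇒b refl = refl

∣p∣≡∑χ-lookup : ∀ {n} (p : Subset n) → ∣ p ∣ ≡ ∑[ a < n ] χ (lookup p a)
∣p∣≡∑χ-lookup []            = refl
∣p∣≡∑χ-lookup (inside  ∷ p) = cong suc (∣p∣≡∑χ-lookup p)
∣p∣≡∑χ-lookup (outside ∷ p) = ∣p∣≡∑χ-lookup p

p∪⁅a⁆≡p[a]≔inside : ∀ {n} (p : Subset n) a → p ∪ ⁅ a ⁆ ≡ p [ a ]≔ inside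
p∪⁅a⁆≡p[a]≔inside (inside  ∷ p) zero    = cong (inside ∷_) (∪-identityʳ p)
p∪⁅a⁆≡p[a]≔inside (outside ∷ p) zero    = cong (inside ∷_) (∪-identityʳ p)
p∪⁅a⁆≡p[a]≔inside (inside  ∷ p) (suc a) = cong (inside ∷_) (p∪⁅a⁆≡p[a]≔inside p a)
p∪⁅a⁆≡p[a]≔inside (outside ∷ p) (suc a) = cong (outside ∷_) (p∪⁅a⁆≡p[a]≔inside p a)

disjointᵇ-⊥ : ∀ {n} (p : Subset n) → disjointᵇ p ⊥ ≡ true
disjointᵇ-⊥ []            = refl
disjointᵇ-⊥ (inside  ∷ p) = disjointᵇ-⊥ p
disjointᵇ-⊥ (outside ∷ p) = disjointᵇ-⊥ p

disjointᵇ-⁅a⁆ : ∀ {n} (p : Subset n) a → disjointᵇ p ⁅ a ⁆ ≡ not (lookup p a)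
disjointᵇ-⁅a⁆ (inside  ∷ p) zero    = refl
disjointᵇ-⁅a⁆ (outside ∷ p) zero    = disjointᵇ-⊥ p
disjointᵇ-⁅a⁆ (inside  ∷ p) (suc a) = disjointᵇ-⁅a⁆ p a
disjointᵇ-⁅a⁆ (outside ∷ p) (suc a) = disjointᵇ-⁅a⁆ p a

∣p[a]≔inside∣ : ∀ {n} (p : Subset n) a → lookup p a ≡ outside → ∣ p [ a ]≔ inside ∣ ≡ suc ∣ p ∣
∣p[a]≔inside∣ (outside ∷ p) zero    _  = refl
∣p[a]≔inside∣ (inside  ∷ p) (suc a) pa = cong suc (∣p[a]≔inside∣ p a pa)
∣p[a]≔inside∣ (outside ∷ p) (suc a) pa = ∣p[a]≔inside∣ p a pa

p⊆p[a]≔inside : ∀ {n} (p : Subset n) a → p ⊆ p [ a ]≔ inside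
p⊆p[a]≔inside (_ ∷ p) zero    here      = here
p⊆p[a]≔inside (_ ∷ p) zero    (there i) = there i
p⊆p[a]≔inside (_ ∷ p) (suc a) here      = here
p⊆p[a]≔inside (_ ∷ p) (suc a) (there i) = there (p⊆p[a]≔inside p a i)

∑ₛ : ∀ n → (Subset n → ℕ) → ℕ
∑ₛ zero    f = f []
∑ₛ (suc n) f = ∑ₛ n (f ∘ (inside ∷_)) + ∑ₛ n (f ∘ (outside ∷_))

∑ₛ-cong : ∀ n {f g : Subset n → ℕ} → (∀ x → f x ≡ g x) → ∑ₛ n f ≡ ∑ₛ n g
∑ₛ-cong zero    f≗g = f≗g []
∑ₛ-cong (suc n) f≗g = cong₂ _+_ (∑ₛ-cong n (f≗g ∘ (inside ∷_))) (∑ₛ-cong n (f≗g ∘ (outside ∷_)))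

∑ₛ-zero : ∀ n → ∑ₛ n (λ _ → 0) ≡ 0
∑ₛ-zero zero    = refl
∑ₛ-zero (suc n) = cong₂ _+_ (∑ₛ-zero n) (∑ₛ-zero n)

*-distribˡ-∑ₛ : ∀ n c (f : Subset n → ℕ) → c * ∑ₛ n f ≡ ∑ₛ n (λ x → c * f x)
*-distribˡ-∑ₛ zero    c f = refl
*-distribˡ-∑ₛ (suc n) c f = trans (*-distribˡ-+ c _ _)
  (cong₂ _+_ (*-distribˡ-∑ₛ n c _) (*-distribˡ-∑ₛ n c _))

∑ₛ-comm-∑ : ∀ n {m} (f : Subset n → Fin m → ℕ) →
  ∑ₛ n (λ x → ∑[ a < m ] f x a) ≡ ∑[ a < m ] ∑ₛ n (λ x → f x a)
∑ₛ-comm-∑ zero    f = refl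
∑ₛ-comm-∑ (suc n) f = trans
  (cong₂ _+_ (∑ₛ-comm-∑ n (f ∘ (inside ∷_))) (∑ₛ-comm-∑ n (f ∘ (outside ∷_))))
  (sym (∑-distrib-+ (λ a → ∑ₛ n (λ x → f (inside ∷ x) a)) (λ a → ∑ₛ n (λ x → f (outside ∷ x) a))))

-- x ↦ x ∪ {a} maps the subsets avoiding a bijectively onto those containing a.
∑ₛ-insert : ∀ n (h : Subset n → ℕ) a →
  ∑ₛ n (λ x → χ (not (lookup x a)) * h (x [ a ]≔ inside)) ≡ ∑ₛ n (λ y → χ (lookup y a) * h y)
∑ₛ-insert (suc n) h zero    = +-comm (∑ₛ n (λ _ → 0)) (∑ₛ n (λ x → h (inside ∷ x) + 0))
∑ₛ-insert (suc n) h (suc a) =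
  cong₂ _+_ (∑ₛ-insert n (h ∘ (inside ∷_)) a) (∑ₛ-insert n (h ∘ (outside ∷_)) a)

∑ₛ-size-zero : ∀ n (P : Subset n → Bool) → ∑ₛ n (λ x → χ (P x ∧ (∣ x ∣ ≡ᵇ 0))) ≡ χ (P ⊥)
∑ₛ-size-zero zero    P = cong χ (∧-identityʳ (P []))
∑ₛ-size-zero (suc n) P = begin
  ∑ₛ n (λ x → χ (P (inside ∷ x) ∧ false)) + rest ≡⟨ cong (_+ rest) (∑ₛ-cong n (cong χ ∘ ∧-zeroʳ ∘ P ∘ (inside ∷_))) ⟩
  ∑ₛ n (λ _ → 0) + rest                          ≡⟨ cong (_+ rest) (∑ₛ-zero n) ⟩
  rest                                           ≡⟨ ∑ₛ-size-zero n (P ∘ (outside ∷_)) ⟩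
  χ (P ⊥)                                        ∎
  where
  rest : ℕ
  rest = ∑ₛ n (λ x → χ (P (outside ∷ x) ∧ (∣ x ∣ ≡ᵇ 0)))

length-filter≡sum-map-χ : ∀ {A : Set} (b : A → Bool) xs →
  length (filter (T? ∘ b) xs) ≡ sum (map (χ ∘ b) xs)
length-filter≡sum-map-χ b []       = refl
length-filter≡sum-map-χ b (x ∷ xs) with b x
... | true  = cong suc (length-filter≡sum-map-χ b xs)
... | false = length-filter≡sum-map-χ b xs

sum-map-allSubsets : ∀ n (f : Subset n → ℕ) → sum (map f (allSubsets n)) ≡ ∑ₛ n f
sum-map-allSubsets zero    f = +-comm (f []) 0
sum-map-allSubsets (suc n) f = begin
  sum (map f (map (inside ∷_) xs ++ map (outside ∷_) xs))
    ≡⟨ cong sum (map-++ f (map (inside ∷_) xs) _) ⟩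
  sum (map f (map (inside ∷_) xs) ++ map f (map (outside ∷_) xs))
    ≡⟨ sum-++ (map f (map (inside ∷_) xs)) _ ⟩
  sum (map f (map (inside ∷_) xs)) + sum (map f (map (outside ∷_) xs))
    ≡⟨ cong₂ _+_ (cong sum (sym (map-∘ xs))) (cong sum (sym (map-∘ xs))) ⟩
  sum (map (f ∘ (inside ∷_)) xs) + sum (map (f ∘ (outside ∷_)) xs)
    ≡⟨ cong₂ _+_ (sum-map-allSubsets n _) (sum-map-allSubsets n _) ⟩
  ∑ₛ (suc n) f ∎
  where
  xs : List (Subset n)
  xs = allSubsets n

factorial-recurrence : (M η : ℕ → ℕ) → M 0 ≡ 1 → (∀ k → suc k * M (suc k) ≡ η k * M k) →
  ∀ k → k ! * M k ≡ prodBelow η k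
factorial-recurrence M η M0 step zero    = cong (_+ 0) M0
factorial-recurrence M η M0 step (suc k) = begin
  suc k * k ! * M (suc k)   ≡⟨ cong (_* M (suc k)) (*-comm (suc k) (k !)) ⟩
  k ! * suc k * M (suc k)   ≡⟨ *-assoc (k !) (suc k) _ ⟩
  k ! * (suc k * M (suc k)) ≡⟨ cong (k ! *_) (trans (step k) (*-comm (η k) (M k))) ⟩
  k ! * (M k * η k)         ≡⟨ sym (*-assoc (k !) (M k) (η k)) ⟩
  k ! * M k * η k           ≡⟨ cong (_* η k) (factorial-recurrence M η M0 step k) ⟩
  prodBelow η k * η k       ∎

module _ {n : ℕ} (C : Configuration n) where
  open Configuration C

  ofSize : ℕ → Subset n → Bool
  ofSize k x = I x ∧ (∣ x ∣ ≡ᵇ k)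

  ofSize-sound : ∀ k x → T (ofSize k x) → I x ≡ true × ∣ x ∣ ≡ k
  ofSize-sound k x t with Equivalence.to T-∧ t
  ... | tI , tk = Equivalence.to T-≡ tI , ≡ᵇ⇒≡ ∣ x ∣ k tk

  N≡∑ₛ : ∀ k → N C k ≡ ∑ₛ n (χ ∘ ofSize k)
  N≡∑ₛ k = trans (length-filter≡sum-map-χ (ofSize k) (allSubsets n)) (sum-map-allSubsets n _)

  I-⊥ : I ⊥ ≡ true
  I-⊥ = downClosed (⊆-min (proj₁ nonempty)) (proj₂ nonempty)

  N-zero : N C 0 ≡ 1
  N-zero = trans (N≡∑ₛ 0) (trans (∑ₛ-size-zero n I) (cong χ I-⊥))

  #Vpar≡∑χ : ∀ x → #Vpar C x ≡ ∑[ a < n ] χ (_∥_ C x ⁅ a ⁆)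
  #Vpar≡∑χ x = trans (∣p∣≡∑χ-lookup (VparSet C x)) (sum-cong-≗ (cong χ ∘ lookup∘tabulate (λ a → _∥_ C x ⁅ a ⁆)))

  ∥⁅a⁆-∧-ofSize : ∀ k x a →
    _∥_ C x ⁅ a ⁆ ∧ ofSize k x ≡ not (lookup x a) ∧ ofSize (suc k) (x [ a ]≔ inside)
  ∥⁅a⁆-∧-ofSize k x a rewrite disjointᵇ-⁅a⁆ x a | p∪⁅a⁆≡p[a]≔inside x a with lookup x a in x∌a
  ... | inside  = refl
  ... | outside rewrite ∣p[a]≔inside∣ x a x∌a =
    ∧-drop-implied (I (x [ a ]≔ inside)) _ (downClosed (p⊆p[a]≔inside x a))

  ∑ₛ-#Vpar : ∀ k → ∑ₛ n (λ x → #Vpar C x * χ (ofSize k x)) ≡ suc k * N C (suc k)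
  ∑ₛ-#Vpar k = begin
    ∑ₛ n (λ x → #Vpar C x * χ (ofSize k x))
      ≡⟨ ∑ₛ-cong n expand-#Vpar ⟩
    ∑ₛ n (λ x → ∑[ a < n ] (χ (_∥_ C x ⁅ a ⁆) * χ (ofSize k x)))
      ≡⟨ ∑ₛ-comm-∑ n (λ x a → χ (_∥_ C x ⁅ a ⁆) * χ (ofSize k x)) ⟩
    ∑[ a < n ] ∑ₛ n (λ x → χ (_∥_ C x ⁅ a ⁆) * χ (ofSize k x))
      ≡⟨ sum-cong-≗ (λ a → ∑ₛ-cong n (extend a)) ⟩
    ∑[ a < n ] ∑ₛ n (λ x → χ (not (lookup x a)) * χ (ofSize (suc k) (x [ a ]≔ inside)))
      ≡⟨ sum-cong-≗ (∑ₛ-insert n (χ ∘ ofSize (suc k))) ⟩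
    ∑[ a < n ] ∑ₛ n (λ y → χ (lookup y a) * χ (ofSize (suc k) y))
      ≡⟨ ∑ₛ-comm-∑ n (λ y a → χ (lookup y a) * χ (ofSize (suc k) y)) ⟨
    ∑ₛ n (λ y → ∑[ a < n ] (χ (lookup y a) * χ (ofSize (suc k) y)))
      ≡⟨ ∑ₛ-cong n expand-size ⟨
    ∑ₛ n (λ y → ∣ y ∣ * χ (ofSize (suc k) y))
      ≡⟨ ∑ₛ-cong n (λ y → *-χ-cong (ofSize (suc k) y) (proj₂ ∘ ofSize-sound (suc k) y)) ⟩
    ∑ₛ n (λ y → suc k * χ (ofSize (suc k) y))
      ≡⟨ *-distribˡ-∑ₛ n (suc k) (χ ∘ ofSize (suc k)) ⟨
    suc k * ∑ₛ n (χ ∘ ofSize (suc k))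
      ≡⟨ cong (suc k *_) (N≡∑ₛ (suc k)) ⟨
    suc k * N C (suc k) ∎
    where
    expand-#Vpar : ∀ x → #Vpar C x * χ (ofSize k x) ≡ ∑[ a < n ] (χ (_∥_ C x ⁅ a ⁆) * χ (ofSize k x))
    expand-#Vpar x = trans (cong (_* χ (ofSize k x)) (#Vpar≡∑χ x))
      (*-distribʳ-sum (χ (ofSize k x)) (λ a → χ (_∥_ C x ⁅ a ⁆)))

    extend : ∀ a x → χ (_∥_ C x ⁅ a ⁆) * χ (ofSize k x) ≡
                     χ (not (lookup x a)) * χ (ofSize (suc k) (x [ a ]≔ inside))
    extend a x = begin
      χ (_∥_ C x ⁅ a ⁆) * χ (ofSize k x)                          ≡⟨ χ-∧ (_∥_ C x ⁅ a ⁆) (ofSize k x) ⟨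
      χ (_∥_ C x ⁅ a ⁆ ∧ ofSize k x)                              ≡⟨ cong χ (∥⁅a⁆-∧-ofSize k x a) ⟩
      χ (not (lookup x a) ∧ ofSize (suc k) (x [ a ]≔ inside))     ≡⟨ χ-∧ (not (lookup x a)) _ ⟩
      χ (not (lookup x a)) * χ (ofSize (suc k) (x [ a ]≔ inside)) ∎

    expand-size : ∀ y → ∣ y ∣ * χ (ofSize (suc k) y) ≡ ∑[ a < n ] (χ (lookup y a) * χ (ofSize (suc k) y))
    expand-size y = trans (cong (_* χ (ofSize (suc k) y)) (∣p∣≡∑χ-lookup y))
      (*-distribʳ-sum (χ (ofSize (suc k) y)) (χ ∘ lookup y))

proposition5 : ∀ (n : ℕ) (C : Configuration n) →
    (∀ (x y : Subset n) → Configuration.I C x ≡ true → Configuration.I C y ≡ true →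
      ∣ x ∣ ≡ ∣ y ∣ → RelIso C x y) →
    ∀ (η : ℕ → ℕ) →
    (∀ (j : ℕ) (x : Subset n) → Configuration.I C x ≡ true → ∣ x ∣ ≡ j → η j ≡ #Vpar C x) →
    (∀ (j : ℕ) → ¬ Σ (Subset n) (λ x → Configuration.I C x ≡ true × ∣ x ∣ ≡ j) → η j ≡ 0) →
    ∀ (k : ℕ) → (k !) * N C k ≡ prodBelow η k
proposition5 n C _ η η≡#Vpar _ = factorial-recurrence (N C) η (N-zero C) double-count
  where
  η-on-layer : ∀ k x → T (ofSize C k x) → η k ≡ #Vpar C x
  η-on-layer k x x∈layer with ofSize-sound C k x x∈layer
  ... | Ix , ∣x∣≡k = η≡#Vpar k x Ix ∣x∣≡k

  double-count : ∀ k → suc k * N C (suc k) ≡ η k * N C k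
  double-count k = begin
    suc k * N C (suc k)                       ≡⟨ ∑ₛ-#Vpar C k ⟨
    ∑ₛ n (λ x → #Vpar C x * χ (ofSize C k x)) ≡⟨ ∑ₛ-cong n (λ x → *-χ-cong (ofSize C k x) (sym ∘ η-on-layer k x)) ⟩
    ∑ₛ n (λ x → η k * χ (ofSize C k x))       ≡⟨ *-distribˡ-∑ₛ n (η k) (χ ∘ ofSize C k) ⟨
    η k * ∑ₛ n (χ ∘ ofSize C k)               ≡⟨ cong (η k *_) (N≡∑ₛ C k) ⟨
    η k * N C k                               ∎
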